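{- Let $\mathcal{H}\subset \binom{[n]}{k}$ and let $t\leq k-1$ be a positive integer. Then there exist $\ell \leq \nu(\mathcal{H})$ and sets $T_1,T_2,\ldots,T_\ell\subset[n]$ such that (i) $|T_i|\leq t$ for all $i=1,2,\ldots,\ell$; (ii) for $i=1,2,\ldots,\ell$, $\mathcal{H}-U_{i-1}$ is a $(|T_{i}|-1)$-resilient $k$-graph with matching number $\nu(\mathcal{H})-i+1$, where $U_{i-1}=T_1\cup T_2\cup \ldots\cup T_{i-1}$ (with $U_0=\emptyset$); (iii) $\mathcal{H}-U$ is a $t$-resilient $k$-graph with matching number $\nu(\mathcal{H})-\ell$, where $U=T_1\cup T_2\cup \ldots\cup T_{\ell}$.
   Context: For a $k$-graph $\mathcal{H}$ (a family of $k$-subsets of $[n]$), $\nu(\mathcal{H})$ is the maximum number of pairwise disjoint edges. For a vertex set $T$, $\mathcal{H}-T$ denotes the $k$-graph of edges of $\mathcal{H}$ disjoint from $T$. $\mathcal{H}$ is $t$-resilient if $\nu(\mathcal{H}-T)=\nu(\mathcal{H})$ for every vertex set $T$ with $|T|\leq t$ (so $0$-resilience is vacuous). -}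

module Defs where

open import Data.Nat using (ℕ; _≤_; _∸_)
open import Data.Bool using (Bool)
open import Data.Fin using (Fin)
open import Data.Fin.Subset using (Subset; _∩_; ⊥; ∣_∣; ⋃)
open import Data.List using (List; filter; length; take)
open import Data.List.Membership.Propositional using (_∈_)
open import Data.List.Relation.Unary.All using (All)
open import Data.List.Relation.Unary.AllPairs using (AllPairs)
open import Data.Vec.Properties using (≡-dec)
open import Data.Vec.Functional using (toList)
import Data.Bool.Properties as B
open import Relation.Binary.PropositionalEquality using (_≡_)
open import Relation.Nullary using (Dec)

Hypergraph : ℕ → Set
Hypergraph n = List (Subset n)

IsKGraph : ∀ {n} → ℕ → Hypergraph n → Set
IsKGraph k H = All (λ e → ∣ e ∣ ≡ k) H

Disjoint : ∀ {n} → Subset n → Subset n → Set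
Disjoint e f = e ∩ f ≡ ⊥

disjoint? : ∀ {n} (e f : Subset n) → Dec (Disjoint e f)
disjoint? e f = ≡-dec B._≟_ (e ∩ f) ⊥

_─ₕ_ : ∀ {n} → Hypergraph n → Subset n → Hypergraph n
H ─ₕ T = filter (λ e → disjoint? e T) H

record Matching {n} (H : Hypergraph n) : Set where
  field
    edges    : List (Subset n)
    inH      : All (_∈ H) edges
    pairwise : AllPairs Disjoint edges

IsMatchingNumber : ∀ {n} → Hypergraph n → ℕ → Set
IsMatchingNumber H m =
  (Σ' (Matching H) (λ M → length (Matching.edges M) ≡ m))
  × ((M : Matching H) → length (Matching.edges M) ≤ m)
  where
    open import Data.Product using (_×_) renaming (Σ to Σ')

Resilient : ∀ {n} → ℕ → Hypergraph n → Set
Resilient {n} t H =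
  ∀ (m : ℕ) → IsMatchingNumber H m →
  ∀ (T : Subset n) → ∣ T ∣ ≤ t → IsMatchingNumber (H ─ₕ T) m

-- U_j = T_1 ∪ ... ∪ T_j for a family T : Fin ℓ → Subset n (indices 0-based).
UnionUpTo : ∀ {n ℓ} → (Fin ℓ → Subset n) → ℕ → Subset n
UnionUpTo T j = ⋃ (take j (toList T))

UnionAll : ∀ {n ℓ} → (Fin ℓ → Subset n) → Subset n
UnionAll T = ⋃ (toList T)

{-# OPTIONS --safe #-}
module Submission where

-- Let ν = ν(H). If every set of at most t vertices leaves a matching of size ν, H is t-resilient
-- and we stop. Otherwise take such a set T₁ of minimum size whose removal destroys all matchings
-- of size ν. By minimality H is (|T₁| − 1)-resilient. Deleting one vertex kills at most one edge
-- of a matching, so removing T₁ − x keeps a ν-matching and removing x as well keeps a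
-- (ν − 1)-matching: ν(H − T₁) = ν − 1. Recurse on H − T₁; the matching number drops each time,
-- so at most ν sets are taken.

open import Defs
open import Data.Nat using (ℕ; zero; suc; _≤_; _<_; _∸_; z≤n; s≤s; s≤s⁻¹; _≤?_)
open import Data.Nat.Properties
  using (≮⇒≥; ≤-<-trans; <-≤-trans; ≤-reflexive; ≤-antisym; m≤n⇒m≤1+n; m≤n⇒m⊓n≡m; suc-injective)
open import Data.Fin using (Fin; toℕ)
import Data.Fin as Fin
open import Data.Fin.Subset using (Subset; ∣_∣; _∪_; ⊥; _-_; _∈_; _∉_; ⁅_⁆)
open import Data.Fin.Subset.Properties
  using (∉⊥; Empty-unique; nonempty?; anySubset?; _∈?_; ∩-comm; ∩-zeroʳ; x∈p∩q⁺; x∈p∩q⁻; x∈p∪q⁺; x∈p∪q⁻;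
         x∈⁅x⁆; x∈⁅y⁆⇒x≡y; ⊆-antisym; p─q⊆p; x∈p∧x≢y⇒x∈p-y; x∈p⇒∣p-x∣<∣p∣)
open import Data.Product using (Σ; _×_; _,_; proj₁; proj₂; ∃)
open import Data.Sum using (_⊎_; inj₁; inj₂; [_,_]′)
open import Data.List using (List; []; _∷_; length; filter; take)
open import Data.List.Properties using (filter-all; filter-accept; filter-reject; length-take)
open import Data.List.Relation.Unary.All using (All; []; _∷_)
import Data.List.Relation.Unary.All as All
import Data.List.Relation.Unary.All.Properties as All
open import Data.List.Relation.Unary.AllPairs using (AllPairs; []; _∷_)
import Data.List.Relation.Unary.AllPairs.Properties as AllPairs
open import Data.List.Relation.Unary.Any using (Any; any?)
import Data.List.Membership.Propositional as List
open import Data.List.Membership.Propositional.Properties using (∈-filter⁺; ∈-filter⁻)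
open import Data.Vec.Functional using () renaming (_∷_ to _∷ᵥ_)
open import Function using (_∘_)
open import Relation.Binary.PropositionalEquality using (_≡_; refl; sym; trans; cong; subst; module ≡-Reasoning)
open import Relation.Nullary using (Dec; yes; no; ¬_)
open import Relation.Nullary.Decidable using (¬?; _×-dec_; map′; decidable-stable)
open import Relation.Nullary.Negation using (contradiction)
open ≡-Reasoning

m≤n∸1⇒m<n : ∀ {m n} → 0 < n → m ≤ n ∸ 1 → m < n
m≤n∸1⇒m<n {n = suc _} _ = s≤s

module _ {n : ℕ} where

  disjoint⇒∉ : ∀ {e f : Subset n} {x} → Disjoint e f → x ∈ e → x ∉ f
  disjoint⇒∉ e∩f≡⊥ x∈e x∈f = ∉⊥ (subst (_ ∈_) e∩f≡⊥ (x∈p∩q⁺ (x∈e , x∈f)))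

  ∉⇒disjoint : ∀ {e f : Subset n} → (∀ {x} → x ∈ e → x ∉ f) → Disjoint e f
  ∉⇒disjoint {e} {f} e∌f = Empty-unique λ (x , x∈e∩f) → let x∈e , x∈f = x∈p∩q⁻ e f x∈e∩f in e∌f x∈e x∈f

  disjoint-sym : ∀ {e f : Subset n} → Disjoint e f → Disjoint f e
  disjoint-sym {e} {f} = trans (∩-comm f e)

  disjoint-∪⁺ : ∀ {e A B : Subset n} → Disjoint e A → Disjoint e B → Disjoint e (A ∪ B)
  disjoint-∪⁺ {A = A} {B} e#A e#B = ∉⇒disjoint λ x∈e x∈A∪B →
    [ disjoint⇒∉ e#A x∈e , disjoint⇒∉ e#B x∈e ]′ (x∈p∪q⁻ A B x∈A∪B)

  disjoint-∪⁻ : ∀ {e A B : Subset n} → Disjoint e (A ∪ B) → Disjoint e A × Disjoint e B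
  disjoint-∪⁻ e#A∪B = ∉⇒disjoint (λ x∈e → disjoint⇒∉ e#A∪B x∈e ∘ x∈p∪q⁺ ∘ inj₁)
                    , ∉⇒disjoint (λ x∈e → disjoint⇒∉ e#A∪B x∈e ∘ x∈p∪q⁺ ∘ inj₂)

  ∉⇒disjoint-⁅⁆ : ∀ {e : Subset n} {x} → x ∉ e → Disjoint e ⁅ x ⁆
  ∉⇒disjoint-⁅⁆ {x = x} x∉e = ∉⇒disjoint λ y∈e y∈⁅x⁆ → x∉e (subst (_∈ _) (x∈⁅y⁆⇒x≡y x y∈⁅x⁆) y∈e)

  x∈p⇒p-x∪⁅x⁆≡p : ∀ {p : Subset n} {x} → x ∈ p → (p - x) ∪ ⁅ x ⁆ ≡ p
  x∈p⇒p-x∪⁅x⁆≡p {p} {x} x∈p =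
    ⊆-antisym (λ y∈ → merge (x∈p∪q⁻ (p - x) ⁅ x ⁆ y∈)) (λ y∈p → x∈p∪q⁺ (split y∈p))
    where
    merge : ∀ {y} → y ∈ p - x ⊎ y ∈ ⁅ x ⁆ → y ∈ p
    merge = [ p─q⊆p p ⁅ x ⁆ , (λ y∈⁅x⁆ → subst (_∈ p) (sym (x∈⁅y⁆⇒x≡y x y∈⁅x⁆)) x∈p) ]′

    split : ∀ {y} → y ∈ p → y ∈ p - x ⊎ y ∈ ⁅ x ⁆
    split {y} y∈p with y Fin.≟ x
    ... | yes refl = inj₂ (x∈⁅x⁆ x)
    ... | no y≢x   = inj₁ (x∈p∧x≢y⇒x∈p-y y∈p y≢x)

  avoids? : (T e : Subset n) → Dec (Disjoint e T)
  avoids? T e = disjoint? e T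

  ∈-─ₕ⁺ : ∀ {G : Hypergraph n} {T e} → e List.∈ G → Disjoint e T → e List.∈ G ─ₕ T
  ∈-─ₕ⁺ {T = T} = ∈-filter⁺ (avoids? T)

  ∈-─ₕ⁻ : ∀ {G : Hypergraph n} {T e} → e List.∈ G ─ₕ T → e List.∈ G × Disjoint e T
  ∈-─ₕ⁻ {G} {T} = ∈-filter⁻ (avoids? T) {xs = G}

  ─ₕ-⊥ : (G : Hypergraph n) → G ─ₕ ⊥ ≡ G
  ─ₕ-⊥ G = filter-all (avoids? ⊥) (All.tabulate λ {e} _ → ∩-zeroʳ e)

  ─ₕ-∷-accept : ∀ (G : Hypergraph n) {e T} → Disjoint e T → (e ∷ G) ─ₕ T ≡ e ∷ (G ─ₕ T)
  ─ₕ-∷-accept G {T = T} = filter-accept (avoids? T) {xs = G}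

  ─ₕ-∷-reject : ∀ (G : Hypergraph n) {e T} → ¬ Disjoint e T → (e ∷ G) ─ₕ T ≡ G ─ₕ T
  ─ₕ-∷-reject G {T = T} = filter-reject (avoids? T) {xs = G}

  ─ₕ-∪ : (G : Hypergraph n) (A B : Subset n) → G ─ₕ (A ∪ B) ≡ (G ─ₕ A) ─ₕ B
  ─ₕ-∪ [] A B = refl
  ─ₕ-∪ (e ∷ G) A B = by-cases (disjoint? e A) (disjoint? e B)
    where
    by-cases : Dec (Disjoint e A) → Dec (Disjoint e B) → (e ∷ G) ─ₕ (A ∪ B) ≡ ((e ∷ G) ─ₕ A) ─ₕ B
    by-cases (yes e#A) (yes e#B) = begin
      (e ∷ G) ─ₕ (A ∪ B)     ≡⟨ ─ₕ-∷-accept G (disjoint-∪⁺ e#A e#B) ⟩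
      e ∷ (G ─ₕ (A ∪ B))     ≡⟨ cong (e ∷_) (─ₕ-∪ G A B) ⟩
      e ∷ ((G ─ₕ A) ─ₕ B)    ≡⟨ ─ₕ-∷-accept (G ─ₕ A) e#B ⟨
      (e ∷ (G ─ₕ A)) ─ₕ B    ≡⟨ cong (_─ₕ B) (─ₕ-∷-accept G e#A) ⟨
      ((e ∷ G) ─ₕ A) ─ₕ B    ∎
    by-cases (yes e#A) (no e∦B) = begin
      (e ∷ G) ─ₕ (A ∪ B)     ≡⟨ ─ₕ-∷-reject G (e∦B ∘ proj₂ ∘ disjoint-∪⁻) ⟩
      G ─ₕ (A ∪ B)           ≡⟨ ─ₕ-∪ G A B ⟩
      (G ─ₕ A) ─ₕ B          ≡⟨ ─ₕ-∷-reject (G ─ₕ A) e∦B ⟨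
      (e ∷ (G ─ₕ A)) ─ₕ B    ≡⟨ cong (_─ₕ B) (─ₕ-∷-accept G e#A) ⟨
      ((e ∷ G) ─ₕ A) ─ₕ B    ∎
    by-cases (no e∦A) _ = begin
      (e ∷ G) ─ₕ (A ∪ B)     ≡⟨ ─ₕ-∷-reject G (e∦A ∘ proj₁ ∘ disjoint-∪⁻) ⟩
      G ─ₕ (A ∪ B)           ≡⟨ ─ₕ-∪ G A B ⟩
      (G ─ₕ A) ─ₕ B          ≡⟨ cong (_─ₕ B) (─ₕ-∷-reject G e∦A) ⟨
      ((e ∷ G) ─ₕ A) ─ₕ B    ∎

  HasMatching : Hypergraph n → ℕ → Set
  HasMatching G m = Σ (Matching G) λ M → length (Matching.edges M) ≡ m

  hasMatching-0 : ∀ {G : Hypergraph n} → HasMatching G 0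
  hasMatching-0 = record { edges = [] ; inH = [] ; pairwise = [] } , refl

  hasMatching-≤ : ∀ {G : Hypergraph n} {j} (M : Matching G) → j ≤ length (Matching.edges M) → HasMatching G j
  hasMatching-≤ {j = j} M j≤∣M∣ =
    record { edges = take j edges ; inH = All.take⁺ j inH ; pairwise = AllPairs.take⁺ j pairwise } ,
    trans (length-take j edges) (m≤n⇒m⊓n≡m j≤∣M∣)
    where open Matching M

  liftMatching : ∀ {G : Hypergraph n} {T} → Matching (G ─ₕ T) → Matching G
  liftMatching M = record { edges = edges ; inH = All.map (proj₁ ∘ ∈-─ₕ⁻) inH ; pairwise = pairwise }
    where open Matching M

  restrictMatching : ∀ {G : Hypergraph n} T → Matching G → Matching (G ─ₕ T)
  restrictMatching T M = record
    { edges    = filter (avoids? T) edges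
    ; inH      = All.zipWith (λ (e∈G , e#T) → ∈-─ₕ⁺ e∈G e#T)
                   (All.filter⁺ (avoids? T) inH , All.all-filter (avoids? T) edges)
    ; pairwise = AllPairs.filter⁺ (avoids? T) pairwise
    }
    where open Matching M

  hasMatching-∷ : ∀ {G : Hypergraph n} {m} → Any (λ e → HasMatching (G ─ₕ e) m) G → HasMatching G (suc m)
  hasMatching-∷ {G} found =
    let e , e∈G , M , ∣M∣≡m = List.find found
        open Matching M
    in record { edges    = e ∷ edges
              ; inH      = e∈G ∷ All.map (proj₁ ∘ ∈-─ₕ⁻ {G}) inH
              ; pairwise = All.map (disjoint-sym ∘ proj₂ ∘ ∈-─ₕ⁻ {G}) inH ∷ pairwise
              } , cong suc ∣M∣≡m

  hasMatching-∷⁻ : ∀ {G : Hypergraph n} {m} → HasMatching G (suc m) → Any (λ e → HasMatching (G ─ₕ e) m) G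
  hasMatching-∷⁻ (record { edges = [] } , ())
  hasMatching-∷⁻ (record { edges = e ∷ es ; inH = e∈G ∷ es⊆G ; pairwise = e#es ∷ es-pairwise } , ∣es∣≡m) =
    List.lose e∈G
      ( record { edges    = es
               ; inH      = All.zipWith (λ (f∈G , e#f) → ∈-─ₕ⁺ f∈G (disjoint-sym e#f)) (es⊆G , e#es)
               ; pairwise = es-pairwise }
      , suc-injective ∣es∣≡m)

  hasMatching? : ∀ (G : Hypergraph n) m → Dec (HasMatching G m)
  hasMatching? G zero    = yes hasMatching-0
  hasMatching? G (suc m) = map′ hasMatching-∷ hasMatching-∷⁻ (any? (λ e → hasMatching? (G ─ₕ e) m) G)

  length≤1+length-avoiding : ∀ x {es : List (Subset n)} → AllPairs Disjoint es →
                             length es ≤ suc (length (filter (avoids? ⁅ x ⁆) es))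
  length≤1+length-avoiding x [] = z≤n
  length≤1+length-avoiding x {e ∷ es} (e#es ∷ es-pairwise) with x ∈? e
  ... | no x∉e = subst (λ l → suc (length es) ≤ suc (length l))
                       (sym (filter-accept (avoids? ⁅ x ⁆) (∉⇒disjoint-⁅⁆ x∉e)))
                       (s≤s (length≤1+length-avoiding x es-pairwise))
  ... | yes x∈e = ≤-reflexive (cong (suc ∘ length) (sym (trans
                    (filter-reject (avoids? ⁅ x ⁆) λ e#x → disjoint⇒∉ e#x x∈e (x∈⁅x⁆ x))
                    (filter-all (avoids? ⁅ x ⁆) (All.map (λ e#f → ∉⇒disjoint-⁅⁆ (disjoint⇒∉ e#f x∈e)) e#es)))))

  hasMatching-─ₕ⁅⁆ : ∀ {G : Hypergraph n} {m} x → HasMatching G (suc m) → HasMatching (G ─ₕ ⁅ x ⁆) m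
  hasMatching-─ₕ⁅⁆ {G} x (M , ∣M∣≡1+m) =
    hasMatching-≤ M-x (s≤s⁻¹ (subst (_≤ suc (length (Matching.edges M-x))) ∣M∣≡1+m
                                     (length≤1+length-avoiding x (Matching.pairwise M))))
    where
    M-x : Matching (G ─ₕ ⁅ x ⁆)
    M-x = restrictMatching ⁅ x ⁆ M

  hasMatching-─ₕ-∈ : ∀ {G : Hypergraph n} {T m x} → x ∈ T →
                     HasMatching (G ─ₕ (T - x)) (suc m) → HasMatching (G ─ₕ T) m
  hasMatching-─ₕ-∈ {G} {T} {m} {x} x∈T = subst (λ G′ → HasMatching G′ m) readd-x ∘ hasMatching-─ₕ⁅⁆ x
    where
    readd-x : (G ─ₕ (T - x)) ─ₕ ⁅ x ⁆ ≡ G ─ₕ T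
    readd-x = begin
      (G ─ₕ (T - x)) ─ₕ ⁅ x ⁆  ≡⟨ ─ₕ-∪ G (T - x) ⁅ x ⁆ ⟨
      G ─ₕ ((T - x) ∪ ⁅ x ⁆)   ≡⟨ cong (G ─ₕ_) (x∈p⇒p-x∪⁅x⁆≡p x∈T) ⟩
      G ─ₕ T                   ∎

  isMatchingNumber : ∀ {G : Hypergraph n} {m} → HasMatching G m → ¬ HasMatching G (suc m) → IsMatchingNumber G m
  isMatchingNumber has ¬has = has , λ M → ≮⇒≥ (¬has ∘ hasMatching-≤ M)

  isMatchingNumber-unique : ∀ {G : Hypergraph n} {m m′} → IsMatchingNumber G m → IsMatchingNumber G m′ → m ≡ m′
  isMatchingNumber-unique ((M , ∣M∣≡m) , ≤m) ((M′ , ∣M′∣≡m′) , ≤m′) =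
    ≤-antisym (subst (_≤ _) ∣M∣≡m (≤m′ M)) (subst (_≤ _) ∣M′∣≡m′ (≤m M′))

  SurvivesRemoval : ℕ → Hypergraph n → ℕ → Set
  SurvivesRemoval s G m = ∀ T → ∣ T ∣ ≤ s → HasMatching (G ─ₕ T) m

  resilient : ∀ {s} {G : Hypergraph n} {m} → IsMatchingNumber G m → SurvivesRemoval s G m → Resilient s G
  resilient {G = G} ν[G]≡m survives m′ ν[G]≡m′ T ∣T∣≤s =
    subst (IsMatchingNumber (G ─ₕ T)) (isMatchingNumber-unique ν[G]≡m ν[G]≡m′)
      (survives T ∣T∣≤s , proj₂ ν[G]≡m ∘ liftMatching {G})

  MinimalObstruction : ℕ → Hypergraph n → ℕ → Subset n → Set
  MinimalObstruction t G m T =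
    ∣ T ∣ ≤ t × ¬ HasMatching (G ─ₕ T) m × (∀ T′ → ∣ T′ ∣ < ∣ T ∣ → HasMatching (G ─ₕ T′) m)

  survives-or-minimalObstruction-at : ∀ t (G : Hypergraph n) m →
    (∀ T → ∣ T ∣ < t → HasMatching (G ─ₕ T) m) → SurvivesRemoval t G m ⊎ ∃ (MinimalObstruction t G m)
  survives-or-minimalObstruction-at t G m survivesBelow
    with anySubset? (λ T → ∣ T ∣ ≤? t ×-dec ¬? (hasMatching? (G ─ₕ T) m))
  ... | yes (T , ∣T∣≤t , breaks) =
    inj₂ (T , ∣T∣≤t , breaks , λ T′ ∣T′∣<∣T∣ → survivesBelow T′ (<-≤-trans ∣T′∣<∣T∣ ∣T∣≤t))
  ... | no noObstruction =
    inj₁ λ T ∣T∣≤t → decidable-stable (hasMatching? (G ─ₕ T) m) (λ breaks → noObstruction (T , ∣T∣≤t , breaks))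

  survives-or-minimalObstruction : ∀ t (G : Hypergraph n) m → SurvivesRemoval t G m ⊎ ∃ (MinimalObstruction t G m)
  survives-or-minimalObstruction zero G m = survives-or-minimalObstruction-at zero G m (λ _ ())
  survives-or-minimalObstruction (suc t) G m with survives-or-minimalObstruction t G m
  ... | inj₁ survives = survives-or-minimalObstruction-at (suc t) G m (λ T → survives T ∘ s≤s⁻¹)
  ... | inj₂ (T , ∣T∣≤t , obstruction) = inj₂ (T , m≤n⇒m≤1+n ∣T∣≤t , obstruction)

  remove-minimalObstruction : ∀ {t} {G : Hypergraph n} {m T} → IsMatchingNumber G (suc m) →
    MinimalObstruction t G (suc m) T → Resilient (∣ T ∣ ∸ 1) G × IsMatchingNumber (G ─ₕ T) m
  remove-minimalObstruction {G = G} {m} {T} ν[G]≡1+m (_ , breaks , smallerSurvive) with nonempty? T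
  ... | no empty = contradiction (subst (λ U → HasMatching (G ─ₕ U) (suc m)) (sym (Empty-unique empty))
                                   (subst (λ G′ → HasMatching G′ (suc m)) (sym (─ₕ-⊥ G)) (proj₁ ν[G]≡1+m)))
                                 breaks
  ... | yes (x , x∈T) =
    resilient ν[G]≡1+m (λ T′ → smallerSurvive T′ ∘ m≤n∸1⇒m<n (≤-<-trans z≤n ∣T-x∣<∣T∣)) ,
    isMatchingNumber (hasMatching-─ₕ-∈ {G} x∈T (smallerSurvive (T - x) ∣T-x∣<∣T∣)) breaks
    where
    ∣T-x∣<∣T∣ : ∣ T - x ∣ < ∣ T ∣
    ∣T-x∣<∣T∣ = x∈p⇒∣p-x∣<∣p∣ x∈T

  ResilientWithν : ℕ → Hypergraph n → ℕ → Set
  ResilientWithν s G m = Resilient s G × IsMatchingNumber G m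

  Decomposition : ℕ → Hypergraph n → ℕ → Set
  Decomposition t H ν = Σ ℕ λ ℓ → ℓ ≤ ν × Σ (Fin ℓ → Subset n) λ T →
      ((i : Fin ℓ) → ∣ T i ∣ ≤ t)
    × ((i : Fin ℓ) → ResilientWithν (∣ T i ∣ ∸ 1) (H ─ₕ UnionUpTo T (toℕ i)) (ν ∸ toℕ i))
    × ResilientWithν t (H ─ₕ UnionAll T) (ν ∸ ℓ)

  resilientWithν-─ₕ-⊥ : ∀ {s m} {H : Hypergraph n} → ResilientWithν s H m → ResilientWithν s (H ─ₕ ⊥) m
  resilientWithν-─ₕ-⊥ {s} {m} {H} = subst (λ G → ResilientWithν s G m) (sym (─ₕ-⊥ H))

  decomposition-[] : ∀ {t ν} {H : Hypergraph n} → ResilientWithν t H ν → Decomposition t H ν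
  decomposition-[] H-resilient = 0 , z≤n , (λ ()) , (λ ()) , (λ ()) , resilientWithν-─ₕ-⊥ H-resilient

  decomposition-∷ : ∀ {t ν T₁} {H : Hypergraph n} → ∣ T₁ ∣ ≤ t → ResilientWithν (∣ T₁ ∣ ∸ 1) H (suc ν) →
                    Decomposition t (H ─ₕ T₁) ν → Decomposition t H (suc ν)
  decomposition-∷ {t} {ν} {T₁} {H} ∣T₁∣≤t H-resilient (ℓ , ℓ≤ν , T , ∣T∣≤t , stages , final) =
    suc ℓ , s≤s ℓ≤ν , T₁ ∷ᵥ T , sizes , stages′ , after-T₁ (UnionAll T) final
    where
    after-T₁ : ∀ {s m} U → ResilientWithν s ((H ─ₕ T₁) ─ₕ U) m → ResilientWithν s (H ─ₕ (T₁ ∪ U)) m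
    after-T₁ {s} {m} U = subst (λ G → ResilientWithν s G m) (sym (─ₕ-∪ H T₁ U))

    sizes : (i : Fin (suc ℓ)) → ∣ (T₁ ∷ᵥ T) i ∣ ≤ t
    sizes Fin.zero    = ∣T₁∣≤t
    sizes (Fin.suc i) = ∣T∣≤t i

    stages′ : (i : Fin (suc ℓ)) → ResilientWithν (∣ (T₁ ∷ᵥ T) i ∣ ∸ 1)
                (H ─ₕ UnionUpTo (T₁ ∷ᵥ T) (toℕ i)) (suc ν ∸ toℕ i)
    stages′ Fin.zero    = resilientWithν-─ₕ-⊥ H-resilient
    stages′ (Fin.suc i) = after-T₁ (UnionUpTo T (toℕ i)) (stages i)

  decompose : ∀ t (H : Hypergraph n) ν → IsMatchingNumber H ν → Decomposition t H ν
  decompose t H ν ν[H]≡ν with survives-or-minimalObstruction t H ν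
  ... | inj₁ survives = decomposition-[] (resilient ν[H]≡ν survives , ν[H]≡ν)
  decompose t H zero    _      | inj₂ (_ , _ , breaks , _) = contradiction hasMatching-0 breaks
  decompose t H (suc ν) ν[H]≡1+ν | inj₂ (T₁ , obstruction) =
    let T₁-resilient , ν[H-T₁]≡ν = remove-minimalObstruction ν[H]≡1+ν obstruction
    in decomposition-∷ (proj₁ obstruction) (T₁-resilient , ν[H]≡1+ν) (decompose t (H ─ₕ T₁) ν ν[H-T₁]≡ν)

fact4p1 : (n k t : ℕ) (H : Hypergraph n) → IsKGraph k H →
    1 ≤ t → t < k →
    (ν : ℕ) → IsMatchingNumber H ν →
    Σ ℕ (λ ℓ → ℓ ≤ ν × Σ (Fin ℓ → Subset n) (λ T →
    ((i : Fin ℓ) → ∣ T i ∣ ≤ t)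
    × ((i : Fin ℓ) →
    Resilient (∣ T i ∣ ∸ 1) (H ─ₕ UnionUpTo T (toℕ i))
    × IsMatchingNumber (H ─ₕ UnionUpTo T (toℕ i)) (ν ∸ toℕ i))
    × (Resilient t (H ─ₕ UnionAll T)
    × IsMatchingNumber (H ─ₕ UnionAll T) (ν ∸ ℓ))))
fact4p1 n k t H _ _ _ = decompose t H
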